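{- For every positive integer $n$, $$\sum_{k=1}^{n}(-1)^{k-1}(k-1)!\,c(n,k)=\sum_{T\in\mathrm{inc}(n)}\mathrm{rgf}_{L_T}(-1).$$
   Context: $c(n,k)$ denotes the (unsigned) Stirling number of the first kind: the number of permutations of $\{1,\dots,n\}$ with exactly $k$ cycles. $\mathrm{inc}(n)$ is the set of increasing trees on labels $1,\dots,n$ (rooted trees with root labelled $1$ and labels increasing from parent to child). For a rooted tree $T$, a pruning is a rooted tree with the same root whose edge set is a subset of the edges of $T$; $L_T$ is the lattice of prunings ordered by inclusion of edges and $\mathrm{rgf}_{L_T}(q)=\sum_{S\in L_T}q^{e(S)}$, with $e(S)$ the number of edges of $S$. -}

module Defs where

open import Data.Nat using (ℕ; zero; suc; _≤_; _≤?_; _!)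
open import Data.Unit using (⊤)
open import Data.Fin using (Fin; zero; suc; toℕ)
open import Data.Fin.Properties using (all?; _≟_)
open import Data.Fin.Subset using (Subset; inside; outside; _∈_; ∣_∣)
open import Data.Fin.Subset.Properties using (_∈?_)
open import Data.Vec using (Vec; []; _∷_; lookup)
open import Data.List using (List; []; _∷_; map; concatMap; filter; allFin; upTo; length; foldr)
open import Data.Integer as ℤ using (ℤ; +_; -_)
open import Data.Sum using (_⊎_)
open import Data.Product using (∃; _,_)
open import Relation.Binary.PropositionalEquality using (_≡_)
open import Relation.Nullary using (Dec; yes; no; ¬_)
open import Relation.Nullary.Decidable using (_→-dec_; _⊎-dec_)
import Data.Nat as ℕ

allVecs : {A : Set} → (n : ℕ) → List A → List (Vec A n)
allVecs zero    xs = [] ∷ []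
allVecs (suc n) xs = concatMap (λ x → map (x ∷_) (allVecs n xs)) xs

allMaps : (n m : ℕ) → List (Vec (Fin m) n)
allMaps n m = allVecs n (allFin m)

sumℤ : List ℤ → ℤ
sumℤ = foldr ℤ._+_ (+ 0)

-- Permutations of {1..n} (0-based: Fin n) and their cycles

Injective : {n : ℕ} → Vec (Fin n) n → Set
Injective {n} σ = (i j : Fin n) → lookup σ i ≡ lookup σ j → i ≡ j

injective? : {n : ℕ} → (σ : Vec (Fin n) n) → Dec (Injective σ)
injective? σ = all? (λ i → all? (λ j → (lookup σ i ≟ lookup σ j) →-dec (i ≟ j)))

perms : (n : ℕ) → List (Vec (Fin n) n)
perms n = filter injective? (allMaps n n)

iter : {n : ℕ} → Vec (Fin n) n → ℕ → Fin n → Fin n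
iter σ zero    i = i
iter σ (suc k) i = lookup σ (iter σ k i)

-- i is the least element of its cycle: every σ^m(i), 1 ≤ m ≤ n, is ≥ i
-- (the orbit of i has at most n elements, so this ranges over the whole cycle)
CycleMin : {n : ℕ} → Vec (Fin n) n → Fin n → Set
CycleMin {n} σ i = (m : Fin n) → toℕ i ≤ toℕ (iter σ (suc (toℕ m)) i)

cycleMin? : {n : ℕ} → (σ : Vec (Fin n) n) → (i : Fin n) → Dec (CycleMin σ i)
cycleMin? σ i = all? (λ m → toℕ i ≤? toℕ (iter σ (suc (toℕ m)) i))

-- number of cycles of σ = number of cycles' least elements
cycles : {n : ℕ} → Vec (Fin n) n → ℕ
cycles {n} σ = length (filter (cycleMin? σ) (allFin n))

stirling1 : ℕ → ℕ → ℕ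
stirling1 n k = length (filter (λ σ → cycles σ ℕ.≟ k) (perms n))

-- Increasing trees on labels 1..(n+1)
-- Vertex labelled (i+2) for i : Fin n is a non-root vertex; its parent is
-- stored as a 0-based label p : Fin (suc n) (p = 0 is the root, label 1).
-- An increasing tree is exactly a parent map with parent label < label,
-- i.e. toℕ p ≤ toℕ i.

IsIncreasing : {n : ℕ} → Vec (Fin (suc n)) n → Set
IsIncreasing {n} par = (i : Fin n) → toℕ (lookup par i) ≤ toℕ i

isIncreasing? : {n : ℕ} → (par : Vec (Fin (suc n)) n) → Dec (IsIncreasing par)
isIncreasing? par = all? (λ i → toℕ (lookup par i) ≤? toℕ i)

-- inc(n+1): all increasing trees on labels 1..n+1, as parent maps
inc : (n : ℕ) → List (Vec (Fin (suc n)) n)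
inc n = filter isIncreasing? (allMaps n (suc n))

-- Each edge of T is (parent(v), v) for a non-root vertex v, so an edge
-- subset is a subset S of non-root vertices (Subset n).  It is a rooted
-- tree with the same root iff it is closed under taking parent edges:
-- if v ∈ S and parent(v) is not the root then parent(v) ∈ S.

ParentOk : {n : ℕ} → Subset n → Fin (suc n) → Set
ParentOk S zero    = ⊤
ParentOk S (suc w) = w ∈ S

parentOk? : {n : ℕ} → (S : Subset n) → (p : Fin (suc n)) → Dec (ParentOk S p)
parentOk? S zero    = yes _
parentOk? S (suc w) = w ∈? S

IsPruning : {n : ℕ} → Vec (Fin (suc n)) n → Subset n → Set
IsPruning {n} par S = (v : Fin n) → v ∈ S → ParentOk S (lookup par v)

isPruning? : {n : ℕ} → (par : Vec (Fin (suc n)) n) → (S : Subset n) → Dec (IsPruning par S)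
isPruning? par S = all? (λ v → (v ∈? S) →-dec parentOk? S (lookup par v))

prunings : {n : ℕ} → Vec (Fin (suc n)) n → List (Subset n)
prunings {n} par = filter (isPruning? par) (allVecs n (inside ∷ outside ∷ []))

rgf : {n : ℕ} → Vec (Fin (suc n)) n → ℤ → ℤ
rgf par q = sumℤ (map (λ S → q ℤ.^ ∣ S ∣) (prunings par))

-- Σ_{k=1}^{n} (-1)^{k-1} (k-1)! c(n,k), indexed by j = k-1 ∈ {0..n-1}
lhs15 : ℕ → ℤ
lhs15 n = sumℤ (map (λ j → ((- (+ 1)) ℤ.^ j) ℤ.* (+ ((j !) ℕ.* stirling1 n (suc j)))) (upTo n))

-- Σ_{T ∈ inc(n)} rgf_{L_T}(-1), for n = suc m
rhs15 : ℕ → ℤ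
rhs15 m = sumℤ (map (λ T → rgf T (- (+ 1))) (inc m))

{-# OPTIONS --safe #-}
-- The Stirling numbers obey c(n+1,k+1) = n c(n,k+1) + c(n,k): a permutation of {0,…,n} arises
-- uniquely by inserting n into a permutation of {0,…,n-1}, either as a new fixed point (one more
-- cycle) or right after one of the n old elements (same cycles).
-- Exchanging the sums over trees and prunings turns the right-hand side into Σ_S (-1)^|S| N(S),
-- where N(S), the number of increasing trees having the edge set S as a pruning, is the product
-- over the vertices of their numbers of admissible parents. Summing out the last vertex shows that,
-- for every weight g, Σ_S g(|S|) N(S) and Σ_j g(j) j! c(m+1,j+1) satisfy the same recursion in m;
-- the weight g(j) = (-1)^j gives the theorem.
module Submission where

open import Defs
open import Level using (0ℓ)
open import Algebra.Bundles using (CommutativeSemiring)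
open import Data.Bool using (true; false; if_then_else_)
open import Data.Empty using (⊥-elim)
open import Data.Unit using (tt)
open import Data.Nat as ℕ using (ℕ; zero; suc; _≤_; _<_; s≤s; _!)
import Data.Nat.Properties as ℕ
open import Data.Nat.DivMod using (_%_; _/_; m≡m%n+[m/n]*n; m%n<n)
open import Data.Nat.Solver using () renaming (module +-*-Solver to ℕ-Solver)
open import Data.Integer as ℤ using (ℤ)
import Data.Integer.Properties as ℤ
open import Data.Integer.Solver using (module +-*-Solver)
open import Data.Fin as Fin using (Fin; zero; suc; toℕ; fromℕ; inject₁; fromℕ<; lower₁)
open import Data.Fin.Properties
  using (all?; ∀-cons-⇔; pigeonhole; toℕ-injective; toℕ-fromℕ<; toℕ<n; toℕ-fromℕ; toℕ-inject₁;
         fromℕ≢inject₁; inject₁-injective; inject₁-lower₁; suc-injective)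
open import Data.Fin.Relation.Unary.Top using (view; ‵fromℕ; ‵inject₁)
open import Data.Fin.Subset using (Subset; inside; outside; ∣_∣) renaming (_∈_ to _∈ₛ_)
open import Data.Fin.Subset.Properties using (_∈?_)
open import Data.List as List
  using (List; []; _∷_; _++_; _∷ʳ_; length; foldr; filter; concatMap; cartesianProductWith; allFin; upTo)
open import Data.List.Properties using (map-∘; map-upTo; upTo-∷ʳ; map-tabulate; length-tabulate)
open import Data.List.Membership.Propositional using (_∈_)
open import Data.List.Membership.Propositional.Properties
  using (∈-filter⁺; ∈-filter⁻; ∈-allFin; ∈-cartesianProductWith⁺; ∈-cartesianProductWith⁻)
open import Data.List.Membership.Propositional.Properties.WithK using (unique∧set⇒bag)
open import Data.List.Relation.Unary.All using ([])
open import Data.List.Relation.Unary.AllPairs using ([]; _∷_)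
open import Data.List.Relation.Unary.Any using (here; there)
open import Data.List.Relation.Unary.Unique.Propositional using (Unique)
open import Data.List.Relation.Unary.Unique.Propositional.Properties using (filter⁺; allFin⁺; cartesianProductWith⁺)
open import Data.List.Relation.Binary.BagAndSetEquality using (∼bag⇒↭)
open import Data.List.Relation.Binary.Permutation.Propositional using (_↭_)
open import Data.List.Relation.Binary.Permutation.Propositional.Properties using (filter-↭; ↭-length)
open import Data.Vec as Vec using (Vec; []; _∷_; lookup; tabulate; _[_]≔_)
open import Data.Vec.Properties
  using (∷-injective; lookup-map; lookup∘updateAt; lookup∘updateAt′; lookup∘tabulate; tabulate∘lookup;
         tabulate-cong; lookup⇒[]=; []=⇒lookup)
open import Data.Product using (∃-syntax; _×_; _,_; proj₂)
open import Data.Sum using (_⊎_; inj₁; inj₂)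
open import Function using (_∘_; _⇔_; mk⇔)
open import Relation.Nullary using (Dec; does; yes; no; ¬_; _×-dec_)
open import Relation.Nullary.Decidable using (dec-true; does-⇔; _→-dec_)
open import Relation.Unary using (Pred; Decidable)

-- Finite sums and products in a commutative semiring

module Sums (R : CommutativeSemiring 0ℓ 0ℓ) where

  open CommutativeSemiring R hiding (zero)
  open import Algebra.Properties.CommutativeSemigroup +-commutativeSemigroup using (interchange)
  open import Algebra.Properties.CommutativeSemigroup *-commutativeSemigroup
    using () renaming (interchange to *-interchange)
  open import Relation.Binary.Reasoning.Setoid setoid
  import Relation.Binary.PropositionalEquality as ≡

  ∑ : {X : Set} → (X → Carrier) → List X → Carrier
  ∑ f xs = foldr _+_ 0# (List.map f xs)

  syntax ∑ (λ x → e) xs = ∑[ x ← xs ] e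

  ∑-cong : {X : Set} {f g : X → Carrier} → (∀ x → f x ≈ g x) → ∀ xs → ∑ f xs ≈ ∑ g xs
  ∑-cong f≈g []       = refl
  ∑-cong f≈g (x ∷ xs) = +-cong (f≈g x) (∑-cong f≈g xs)

  ∑-cong-∈ : {X : Set} {f g : X → Carrier} (xs : List X) → (∀ {x} → x ∈ xs → f x ≈ g x) → ∑ f xs ≈ ∑ g xs
  ∑-cong-∈ []       f≈g = refl
  ∑-cong-∈ (x ∷ xs) f≈g = +-cong (f≈g (here ≡.refl)) (∑-cong-∈ xs (f≈g ∘ there))

  ∑-++ : {X : Set} (f : X → Carrier) (xs ys : List X) → ∑ f (xs ++ ys) ≈ ∑ f xs + ∑ f ys
  ∑-++ f []       ys = sym (+-identityˡ _)
  ∑-++ f (x ∷ xs) ys = trans (+-congˡ (∑-++ f xs ys)) (sym (+-assoc _ _ _))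

  ∑-map : {X Y : Set} (f : Y → Carrier) (g : X → Y) (xs : List X) → ∑ f (List.map g xs) ≈ ∑ (f ∘ g) xs
  ∑-map f g xs = reflexive (≡.cong (foldr _+_ 0#) (≡.sym (map-∘ xs)))

  ∑-concatMap : {X Y : Set} (f : Y → Carrier) (g : X → List Y) (xs : List X) →
                ∑ f (concatMap g xs) ≈ ∑[ x ← xs ] ∑ f (g x)
  ∑-concatMap f g []       = refl
  ∑-concatMap f g (x ∷ xs) = trans (∑-++ f (g x) _) (+-congˡ (∑-concatMap f g xs))

  ∑-zero : {X : Set} (xs : List X) → ∑ (λ _ → 0#) xs ≈ 0#
  ∑-zero []       = refl
  ∑-zero (x ∷ xs) = trans (+-identityˡ _) (∑-zero xs)

  ∑-+ : {X : Set} (f g : X → Carrier) (xs : List X) → ∑[ x ← xs ] (f x + g x) ≈ ∑ f xs + ∑ g xs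
  ∑-+ f g []       = sym (+-identityˡ 0#)
  ∑-+ f g (x ∷ xs) = trans (+-congˡ (∑-+ f g xs)) (interchange _ _ _ _)

  ∑-*ˡ : {X : Set} (a : Carrier) (f : X → Carrier) (xs : List X) → a * ∑ f xs ≈ ∑[ x ← xs ] (a * f x)
  ∑-*ˡ a f []       = zeroʳ a
  ∑-*ˡ a f (x ∷ xs) = trans (distribˡ a _ _) (+-congˡ (∑-*ˡ a f xs))

  ∑-*ʳ : {X : Set} (a : Carrier) (f : X → Carrier) (xs : List X) → ∑ f xs * a ≈ ∑[ x ← xs ] (f x * a)
  ∑-*ʳ a f []       = zeroˡ a
  ∑-*ʳ a f (x ∷ xs) = trans (distribʳ a _ _) (+-congˡ (∑-*ʳ a f xs))

  ∑-comm : {X Y : Set} (f : X → Y → Carrier) (xs : List X) (ys : List Y) →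
           ∑[ x ← xs ] ∑[ y ← ys ] f x y ≈ ∑[ y ← ys ] ∑[ x ← xs ] f x y
  ∑-comm f []       ys = sym (∑-zero ys)
  ∑-comm f (x ∷ xs) ys = trans (+-congˡ (∑-comm f xs ys)) (sym (∑-+ (f x) _ ys))

  ∑-upTo-suc : ∀ (f : ℕ → Carrier) n → ∑ f (upTo (suc n)) ≈ f 0 + ∑ (f ∘ suc) (upTo n)
  ∑-upTo-suc f n = +-congˡ (trans (reflexive (≡.cong (∑ f) (≡.sym (map-upTo suc n)))) (∑-map f suc (upTo n)))

  ∑-upTo-∷ʳ : ∀ (f : ℕ → Carrier) n → ∑ f (upTo (suc n)) ≈ ∑ f (upTo n) + f n
  ∑-upTo-∷ʳ f n = begin
    ∑ f (upTo (suc n))        ≡⟨ ≡.cong (∑ f) (upTo-∷ʳ n) ⟨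
    ∑ f (upTo n ∷ʳ n)         ≈⟨ ∑-++ f (upTo n) _ ⟩
    ∑ f (upTo n) + (f n + 0#) ≈⟨ +-congˡ (+-identityʳ _) ⟩
    ∑ f (upTo n) + f n        ∎

  ∑-allFin-suc : ∀ {n} (f : Fin (suc n) → Carrier) → ∑ f (allFin (suc n)) ≈ f zero + ∑ (f ∘ suc) (allFin n)
  ∑-allFin-suc {n} f =
    +-congˡ (trans (reflexive (≡.cong (∑ f) (≡.sym (map-tabulate (λ i → i) suc)))) (∑-map f suc (allFin n)))

  ∑-allFin-init-last : ∀ {n} (f : Fin (suc n) → Carrier) →
                       ∑ f (allFin (suc n)) ≈ ∑ (f ∘ inject₁) (allFin n) + f (fromℕ n)
  ∑-allFin-init-last {zero}  f = trans (+-identityʳ _) (sym (+-identityˡ _))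
  ∑-allFin-init-last {suc n} f = begin
    ∑ f (allFin (suc (suc n)))                                       ≈⟨ ∑-allFin-suc f ⟩
    f zero + ∑ (f ∘ suc) (allFin (suc n))                            ≈⟨ +-congˡ (∑-allFin-init-last (f ∘ suc)) ⟩
    f zero + (∑ (f ∘ suc ∘ inject₁) (allFin n) + f (fromℕ (suc n)))  ≈⟨ +-assoc _ _ _ ⟨
    f zero + ∑ (f ∘ suc ∘ inject₁) (allFin n) + f (fromℕ (suc n))    ≈⟨ +-congʳ (∑-allFin-suc (f ∘ inject₁)) ⟨
    ∑ (f ∘ inject₁) (allFin (suc n)) + f (fromℕ (suc n))             ∎

  ∏ : ∀ {n} → (Fin n → Carrier) → Carrier
  ∏ {zero}  f = 1#
  ∏ {suc n} f = f zero * ∏ (f ∘ suc)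

  syntax ∏ (λ i → e) = ∏[ i ] e

  ∏-cong : ∀ {n} {f g : Fin n → Carrier} → (∀ i → f i ≈ g i) → ∏ f ≈ ∏ g
  ∏-cong {zero}  f≈g = refl
  ∏-cong {suc n} f≈g = *-cong (f≈g zero) (∏-cong (f≈g ∘ suc))

  ∏-distrib : ∀ {n} (f g : Fin n → Carrier) → ∏[ i ] (f i * g i) ≈ ∏ f * ∏ g
  ∏-distrib {zero}  f g = sym (*-identityˡ 1#)
  ∏-distrib {suc n} f g = trans (*-congˡ (∏-distrib (f ∘ suc) (g ∘ suc))) (*-interchange _ _ _ _)

  ∏-init-last : ∀ {n} (f : Fin (suc n) → Carrier) → ∏ f ≈ ∏ (f ∘ inject₁) * f (fromℕ n)
  ∏-init-last {zero}  f = trans (*-identityʳ _) (sym (*-identityˡ _))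
  ∏-init-last {suc n} f = trans (*-congˡ (∏-init-last (f ∘ suc))) (sym (*-assoc _ _ _))

  ∑-allVecs-∏ : {X : Set} (n : ℕ) (xs : List X) (w : Fin n → X → Carrier) →
                ∑[ v ← allVecs n xs ] ∏[ i ] w i (lookup v i) ≈ ∏[ i ] ∑ (w i) xs
  ∑-allVecs-∏ zero    xs w = +-identityʳ 1#
  ∑-allVecs-∏ (suc n) xs w = begin
    ∑ F (concatMap (λ x → List.map (x ∷_) (allVecs n xs)) xs)
      ≈⟨ ∑-concatMap F (λ x → List.map (x ∷_) (allVecs n xs)) xs ⟩
    ∑[ x ← xs ] ∑ F (List.map (x ∷_) (allVecs n xs))
      ≈⟨ ∑-cong (λ x → ∑-map F (x ∷_) (allVecs n xs)) xs ⟩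
    ∑[ x ← xs ] ∑[ v ← allVecs n xs ] (w zero x * ∏[ i ] w (suc i) (lookup v i))
      ≈⟨ ∑-cong (λ x → sym (∑-*ˡ (w zero x) (λ v → ∏[ i ] w (suc i) (lookup v i)) (allVecs n xs))) xs ⟩
    ∑[ x ← xs ] (w zero x * ∑[ v ← allVecs n xs ] ∏[ i ] w (suc i) (lookup v i))
      ≈⟨ ∑-cong (λ x → *-congˡ (∑-allVecs-∏ n xs (λ i → w (suc i)))) xs ⟩
    ∑[ x ← xs ] (w zero x * ∏[ i ] ∑ (w (suc i)) xs)
      ≈⟨ ∑-*ʳ _ (w zero) xs ⟨
    ∑ (w zero) xs * ∏[ i ] ∑ (w (suc i)) xs
      ∎
    where F = λ v → ∏[ i ] w i (lookup v i)

  ∑-allVecs-∷ʳ : {X : Set} (n : ℕ) (xs : List X) (f : Vec X (suc n) → Carrier) →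
                 ∑ f (allVecs (suc n) xs) ≈ ∑[ v ← allVecs n xs ] ∑[ x ← xs ] f (v Vec.∷ʳ x)
  ∑-allVecs-∷ʳ zero    xs f = begin
    ∑ f (concatMap (λ x → List.map (x ∷_) (allVecs 0 xs)) xs)  ≈⟨ ∑-concatMap f _ xs ⟩
    ∑[ x ← xs ] (f (x ∷ []) + 0#)                              ≈⟨ ∑-cong (λ x → +-identityʳ _) xs ⟩
    ∑[ x ← xs ] f (x ∷ [])                                     ≈⟨ +-identityʳ _ ⟨
    ∑[ x ← xs ] f (x ∷ []) + 0#                                ∎
  ∑-allVecs-∷ʳ (suc n) xs f = begin
    ∑ f (concatMap (λ y → List.map (y ∷_) (allVecs (suc n) xs)) xs)
      ≈⟨ ∑-concatMap f _ xs ⟩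
    ∑[ y ← xs ] ∑ f (List.map (y ∷_) (allVecs (suc n) xs))
      ≈⟨ ∑-cong (λ y → trans (∑-map f (y ∷_) (allVecs (suc n) xs)) (∑-allVecs-∷ʳ n xs (f ∘ (y ∷_)))) xs ⟩
    ∑[ y ← xs ] ∑[ v ← allVecs n xs ] ∑[ x ← xs ] f (y ∷ (v Vec.∷ʳ x))
      ≈⟨ ∑-cong (λ y → ∑-map G (y ∷_) (allVecs n xs)) xs ⟨
    ∑[ y ← xs ] ∑ G (List.map (y ∷_) (allVecs n xs))
      ≈⟨ ∑-concatMap G (λ y → List.map (y ∷_) (allVecs n xs)) xs ⟨
    ∑ G (concatMap (λ y → List.map (y ∷_) (allVecs n xs)) xs)
      ∎
    where G = λ v → ∑[ x ← xs ] f (v Vec.∷ʳ x)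

  𝟙 : ∀ {p} {P : Set p} → Dec P → Carrier
  𝟙 P? = if does P? then 1# else 0#

  𝟙-⇔ : ∀ {p q} {P : Set p} {Q : Set q} → P ⇔ Q → (P? : Dec P) (Q? : Dec Q) → 𝟙 P? ≈ 𝟙 Q?
  𝟙-⇔ P⇔Q P? Q? = reflexive (≡.cong (if_then 1# else 0#) (does-⇔ P⇔Q P? Q?))

  𝟙-yes : ∀ {p} {P : Set p} → P → (P? : Dec P) → 𝟙 P? ≈ 1#
  𝟙-yes p P? = reflexive (≡.cong (if_then 1# else 0#) (dec-true P? p))

  𝟙-×-dec : ∀ {p q} {P : Set p} {Q : Set q} (P? : Dec P) (Q? : Dec Q) → 𝟙 (P? ×-dec Q?) ≈ 𝟙 P? * 𝟙 Q?
  𝟙-×-dec (yes _) Q? = sym (*-identityˡ _)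
  𝟙-×-dec (no _)  Q? = sym (zeroˡ _)

  𝟙-all? : ∀ {n p} {P : Pred (Fin n) p} (P? : Decidable P) → 𝟙 (all? P?) ≈ ∏[ i ] 𝟙 (P? i)
  𝟙-all? {zero}  P? = refl
  𝟙-all? {suc n} P? = begin
    𝟙 (all? P?)                        ≈⟨ 𝟙-⇔ ∀-cons-⇔ (P? zero ×-dec all? (P? ∘ suc)) (all? P?) ⟨
    𝟙 (P? zero ×-dec all? (P? ∘ suc))  ≈⟨ 𝟙-×-dec (P? zero) (all? (P? ∘ suc)) ⟩
    𝟙 (P? zero) * 𝟙 (all? (P? ∘ suc))  ≈⟨ *-congˡ (𝟙-all? (P? ∘ suc)) ⟩
    ∏[ i ] 𝟙 (P? i)                    ∎

  ∑-filter : ∀ {X : Set} {p} {P : Pred X p} (P? : Decidable P) (f : X → Carrier) xs →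
             ∑ f (filter P? xs) ≈ ∑[ x ← xs ] (𝟙 (P? x) * f x)
  ∑-filter P? f []       = refl
  ∑-filter P? f (x ∷ xs) with does (P? x)
  ... | true  = +-cong (sym (*-identityˡ _)) (∑-filter P? f xs)
  ... | false = trans (∑-filter P? f xs) (sym (trans (+-congʳ (zeroˡ _)) (+-identityˡ _)))

open import Relation.Binary.PropositionalEquality

-- Orbits of a permutation

iter-+ : ∀ {n} (σ : Vec (Fin n) n) a b i → iter σ (a ℕ.+ b) i ≡ iter σ a (iter σ b i)
iter-+ σ zero    b i = refl
iter-+ σ (suc a) b i = cong (lookup σ) (iter-+ σ a b i)

iter-injective : ∀ {n} (σ : Vec (Fin n) n) → Injective σ → ∀ k {i j} → iter σ k i ≡ iter σ k j → i ≡ j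
iter-injective σ σ-inj zero    eq = eq
iter-injective σ σ-inj (suc k) eq = iter-injective σ σ-inj k (σ-inj _ _ eq)

iter-period : ∀ {n} (σ : Vec (Fin n) n) → Injective σ → ∀ i → ∃[ p ] p < n × iter σ (suc p) i ≡ i
iter-period {suc n} σ σ-inj i with pigeonhole (ℕ.n<1+n (suc n)) (λ a → iter σ (toℕ a) i)
... | a , b , a<b , eq with ℕ.m≤n⇒∃[o]m+o≡n a<b
... | p , a+1+p≡b = p , p<n , iter-injective σ σ-inj (toℕ a) (begin
    iter σ (toℕ a) (iter σ (suc p) i)  ≡⟨ iter-+ σ (toℕ a) (suc p) i ⟨
    iter σ (toℕ a ℕ.+ suc p) i         ≡⟨ cong (λ k → iter σ k i) (trans (ℕ.+-suc (toℕ a) p) a+1+p≡b) ⟩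
    iter σ (toℕ b) i                   ≡⟨ eq ⟨
    iter σ (toℕ a) i                   ∎)
  where
  open ≡-Reasoning
  p<n : p < suc n
  p<n = ℕ.≤-trans (ℕ.≤-trans (s≤s (ℕ.m≤n+m p (toℕ a))) (ℕ.≤-reflexive a+1+p≡b)) (ℕ.s≤s⁻¹ (toℕ<n b))

iter-*-period : ∀ {n} (σ : Vec (Fin n) n) {d i} → iter σ d i ≡ i → ∀ q → iter σ (q ℕ.* d) i ≡ i
iter-*-period σ         period zero    = refl
iter-*-period σ {d} {i} period (suc q) =
  trans (iter-+ σ d (q ℕ.* d) i) (trans (cong (iter σ d) (iter-*-period σ period q)) period)

LeastInOrbit : ∀ {n} → Vec (Fin n) n → Fin n → Set
LeastInOrbit σ i = ∀ k → toℕ i ≤ toℕ (iter σ k i)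

leastInOrbit⇒cycleMin : ∀ {n} (σ : Vec (Fin n) n) {i} → LeastInOrbit σ i → CycleMin σ i
leastInOrbit⇒cycleMin σ least m = least (suc (toℕ m))

-- Every orbit has length at most n, so the n tests in CycleMin cover it.
cycleMin⇒leastInOrbit : ∀ {n} (σ : Vec (Fin n) n) → Injective σ → ∀ {i} → CycleMin σ i → LeastInOrbit σ i
cycleMin⇒leastInOrbit σ σ-inj {i} min k with iter-period σ σ-inj i
... | p , p<n , period = subst (λ x → toℕ i ≤ toℕ x) (sym reduce) (bounded (k % suc p) (m%n<n k (suc p)))
  where
  open ≡-Reasoning
  reduce : iter σ k i ≡ iter σ (k % suc p) i
  reduce = begin
    iter σ k i                                            ≡⟨ cong (λ m → iter σ m i) (m≡m%n+[m/n]*n k (suc p)) ⟩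
    iter σ (k % suc p ℕ.+ (k / suc p) ℕ.* suc p) i        ≡⟨ iter-+ σ (k % suc p) _ i ⟩
    iter σ (k % suc p) (iter σ ((k / suc p) ℕ.* suc p) i) ≡⟨ cong (iter σ (k % suc p))
                                                                  (iter-*-period σ period (k / suc p)) ⟩
    iter σ (k % suc p) i                                  ∎
  bounded : ∀ r → r < suc p → toℕ i ≤ toℕ (iter σ r i)
  bounded zero    _   = ℕ.≤-refl
  bounded (suc r) r<p = subst (λ m → toℕ i ≤ toℕ (iter σ (suc m) i)) (toℕ-fromℕ< r<n) (min (fromℕ< r<n))
    where r<n = ℕ.<-trans (ℕ.s≤s⁻¹ r<p) p<n

-- Inserting a new maximum into a permutation

lookup-∷ʳ-inject₁ : ∀ {A : Set} {n} (xs : Vec A n) x i → lookup (xs Vec.∷ʳ x) (inject₁ i) ≡ lookup xs i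
lookup-∷ʳ-inject₁ (y ∷ xs) x zero    = refl
lookup-∷ʳ-inject₁ (y ∷ xs) x (suc i) = lookup-∷ʳ-inject₁ xs x i

lookup-∷ʳ-fromℕ : ∀ {A : Set} {n} (xs : Vec A n) x → lookup (xs Vec.∷ʳ x) (fromℕ n) ≡ x
lookup-∷ʳ-fromℕ []       x = refl
lookup-∷ʳ-fromℕ (y ∷ xs) x = lookup-∷ʳ-fromℕ xs x

lookup-ext : ∀ {A : Set} {n} {xs ys : Vec A n} → (∀ i → lookup xs i ≡ lookup ys i) → xs ≡ ys
lookup-ext {xs = xs} {ys} eq = trans (sym (tabulate∘lookup xs)) (trans (tabulate-cong eq) (tabulate∘lookup ys))

-- The new maximum n is put into the cycle of τ right after j (for c = suc j),
-- or becomes a new fixed point (for c = zero).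
insertMax : ∀ {n} → Vec (Fin n) n → Fin (suc n) → Vec (Fin (suc n)) (suc n)
insertMax {n} τ zero    = Vec.map inject₁ τ Vec.∷ʳ fromℕ n
insertMax {n} τ (suc j) = (Vec.map inject₁ τ [ j ]≔ fromℕ n) Vec.∷ʳ inject₁ (lookup τ j)

module _ {n} (τ : Vec (Fin n) n) where

  insertMax-max-zero : lookup (insertMax τ zero) (fromℕ n) ≡ fromℕ n
  insertMax-max-zero = lookup-∷ʳ-fromℕ (Vec.map inject₁ τ) (fromℕ n)

  insertMax-max-suc : ∀ j → lookup (insertMax τ (suc j)) (fromℕ n) ≡ inject₁ (lookup τ j)
  insertMax-max-suc j = lookup-∷ʳ-fromℕ (Vec.map inject₁ τ [ j ]≔ fromℕ n) (inject₁ (lookup τ j))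

  insertMax-at : ∀ j → lookup (insertMax τ (suc j)) (inject₁ j) ≡ fromℕ n
  insertMax-at j = trans (lookup-∷ʳ-inject₁ (Vec.map inject₁ τ [ j ]≔ fromℕ n) (inject₁ (lookup τ j)) j)
                         (lookup∘updateAt j (Vec.map inject₁ τ))

  insertMax-old : ∀ c y → c ≢ suc y → lookup (insertMax τ c) (inject₁ y) ≡ inject₁ (lookup τ y)
  insertMax-old zero    y _   = trans (lookup-∷ʳ-inject₁ (Vec.map inject₁ τ) (fromℕ n) y) (lookup-map y inject₁ τ)
  insertMax-old (suc j) y c≢y = begin
    lookup (insertMax τ (suc j)) (inject₁ y)
      ≡⟨ lookup-∷ʳ-inject₁ (Vec.map inject₁ τ [ j ]≔ fromℕ n) (inject₁ (lookup τ j)) y ⟩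
    lookup (Vec.map inject₁ τ [ j ]≔ fromℕ n) y
      ≡⟨ lookup∘updateAt′ y j (c≢y ∘ cong suc ∘ sym) (Vec.map inject₁ τ) ⟩
    lookup (Vec.map inject₁ τ) y
      ≡⟨ lookup-map y inject₁ τ ⟩
    inject₁ (lookup τ y)
      ∎
    where open ≡-Reasoning

  module _ (c : Fin (suc n)) where

    private
      σ = insertMax τ c

    insertMax-step : ∀ y → lookup σ (inject₁ y) ≡ inject₁ (lookup τ y)
                         ⊎ (lookup σ (inject₁ y) ≡ fromℕ n × lookup σ (fromℕ n) ≡ inject₁ (lookup τ y))
    insertMax-step y with c Fin.≟ suc y
    ... | yes refl = inj₂ (insertMax-at y , insertMax-max-suc y)
    ... | no c≢y   = inj₁ (insertMax-old c y c≢y)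

    insertMax-hits-max : ∀ y → lookup σ (inject₁ y) ≡ fromℕ n → c ≡ suc y
    insertMax-hits-max y eq with c Fin.≟ suc y
    ... | yes c≡y = c≡y
    ... | no c≢y  = ⊥-elim (fromℕ≢inject₁ (trans (sym eq) (insertMax-old c y c≢y)))

    insertMax-old-injective : Injective τ → ∀ y y′ → lookup σ (inject₁ y) ≡ lookup σ (inject₁ y′) → y ≡ y′
    insertMax-old-injective τ-inj y y′ eq with insertMax-step y | insertMax-step y′
    ... | inj₁ e       | inj₁ e′       = τ-inj y y′ (inject₁-injective (trans (sym e) (trans eq e′)))
    ... | inj₁ e       | inj₂ (e′ , _) = ⊥-elim (fromℕ≢inject₁ (trans (sym e′) (trans (sym eq) e)))
    ... | inj₂ (e , _) | inj₁ e′       = ⊥-elim (fromℕ≢inject₁ (trans (sym e) (trans eq e′)))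
    ... | inj₂ (e , _) | inj₂ (e′ , _) = suc-injective (trans (sym (insertMax-hits-max y e)) (insertMax-hits-max y′ e′))

    insertMax-orbit : ∀ y k → ∃[ k′ ] iter σ k′ (inject₁ y) ≡ inject₁ (iter τ k y)
    insertMax-orbit y zero    = 0 , refl
    insertMax-orbit y (suc k) with insertMax-orbit y k | insertMax-step (iter τ k y)
    ... | k′ , e | inj₁ e₁        = suc k′ , trans (cong (lookup σ) e) e₁
    ... | k′ , e | inj₂ (e₁ , e₂) = suc (suc k′) , trans (cong (lookup σ) (trans (cong (lookup σ) e) e₁)) e₂

    -- The σ-orbit of inject₁ y is the τ-orbit of y, with n possibly spliced in.
    OnOrbit : Fin n → Fin (suc n) → Set
    OnOrbit y x = (∃[ k ] x ≡ inject₁ (iter τ k y))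
                ⊎ (x ≡ fromℕ n × ∃[ k ] lookup σ (fromℕ n) ≡ inject₁ (iter τ k y))

    onOrbit-step : ∀ {y x} → OnOrbit y x → OnOrbit y (lookup σ x)
    onOrbit-step {y} (inj₁ (k , refl)) with insertMax-step (iter τ k y)
    ... | inj₁ e         = inj₁ (suc k , e)
    ... | inj₂ (e₁ , e₂) = inj₂ (e₁ , suc k , e₂)
    onOrbit-step (inj₂ (refl , k , e)) = inj₁ (k , e)

    onOrbit-iter : ∀ y k → OnOrbit y (iter σ k (inject₁ y))
    onOrbit-iter y zero    = inj₁ (0 , refl)
    onOrbit-iter y (suc k) = onOrbit-step (onOrbit-iter y k)

    leastInOrbit-insertMax⁺ : ∀ {y} → LeastInOrbit τ y → LeastInOrbit σ (inject₁ y)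
    leastInOrbit-insertMax⁺ {y} least k with onOrbit-iter y k
    ... | inj₁ (k′ , e) = subst₂ _≤_ (sym (toℕ-inject₁ y))
                                     (trans (sym (toℕ-inject₁ _)) (cong toℕ (sym e))) (least k′)
    ... | inj₂ (e , _)  = subst₂ _≤_ (sym (toℕ-inject₁ y))
                                     (trans (sym (toℕ-fromℕ n)) (cong toℕ (sym e))) (ℕ.<⇒≤ (toℕ<n y))

    leastInOrbit-insertMax⁻ : ∀ {y} → LeastInOrbit σ (inject₁ y) → LeastInOrbit τ y
    leastInOrbit-insertMax⁻ {y} least k with insertMax-orbit y k
    ... | k′ , e = subst₂ _≤_ (toℕ-inject₁ y) (trans (cong toℕ e) (toℕ-inject₁ _)) (least k′)

  insertMax-old≢max : Injective τ → ∀ c y → lookup (insertMax τ c) (inject₁ y) ≢ lookup (insertMax τ c) (fromℕ n)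
  insertMax-old≢max τ-inj zero y eq =
    fromℕ≢inject₁ (trans (sym insertMax-max-zero) (trans (sym eq) (insertMax-old zero y λ ())))
  insertMax-old≢max τ-inj (suc j) y eq with y Fin.≟ j
  ... | yes refl = fromℕ≢inject₁ (trans (sym (insertMax-at j)) (trans eq (insertMax-max-suc j)))
  ... | no y≢j   = y≢j (τ-inj y j (inject₁-injective
                     (trans (sym (insertMax-old (suc j) y (y≢j ∘ suc-injective ∘ sym))) (trans eq (insertMax-max-suc j)))))

  insertMax-injective : Injective τ → ∀ c → Injective (insertMax τ c)
  insertMax-injective τ-inj c x x′ eq with view x | view x′
  ... | ‵fromℕ     | ‵fromℕ      = refl
  ... | ‵fromℕ     | ‵inject₁ y′ = ⊥-elim (insertMax-old≢max τ-inj c y′ (sym eq))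
  ... | ‵inject₁ y | ‵fromℕ      = ⊥-elim (insertMax-old≢max τ-inj c y eq)
  ... | ‵inject₁ y | ‵inject₁ y′ = cong inject₁ (insertMax-old-injective c τ-inj y y′ eq)

  cycleMin-insertMax-zero : CycleMin (insertMax τ zero) (fromℕ n)
  cycleMin-insertMax-zero = leastInOrbit⇒cycleMin (insertMax τ zero) (λ k → ℕ.≤-reflexive (cong toℕ (sym (fixed k))))
    where
    fixed : ∀ k → iter (insertMax τ zero) k (fromℕ n) ≡ fromℕ n
    fixed zero    = refl
    fixed (suc k) = trans (cong (lookup (insertMax τ zero)) (fixed k)) insertMax-max-zero

  ¬cycleMin-insertMax-suc : ∀ j → ¬ CycleMin (insertMax τ (suc j)) (fromℕ n)
  ¬cycleMin-insertMax-suc j min =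
    ℕ.<⇒≱ τj<n (subst (λ x → toℕ (fromℕ n) ≤ toℕ x) (insertMax-max-suc j) (min zero))
    where
    τj<n : toℕ (inject₁ (lookup τ j)) < toℕ (fromℕ n)
    τj<n = subst₂ _<_ (sym (toℕ-inject₁ _)) (sym (toℕ-fromℕ n)) (toℕ<n (lookup τ j))

  cycleMin-insertMax-max : ∀ c → CycleMin (insertMax τ c) (fromℕ n) ⇔ c ≡ zero
  cycleMin-insertMax-max zero    = mk⇔ (λ _ → refl) (λ _ → cycleMin-insertMax-zero)
  cycleMin-insertMax-max (suc j) = mk⇔ (⊥-elim ∘ ¬cycleMin-insertMax-suc j) (λ ())

  cycleMin-insertMax-old : Injective τ → ∀ c y → CycleMin (insertMax τ c) (inject₁ y) ⇔ CycleMin τ y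
  cycleMin-insertMax-old τ-inj c y = mk⇔
    (leastInOrbit⇒cycleMin τ ∘ leastInOrbit-insertMax⁻ c ∘ cycleMin⇒leastInOrbit σ (insertMax-injective τ-inj c))
    (leastInOrbit⇒cycleMin σ ∘ leastInOrbit-insertMax⁺ c ∘ cycleMin⇒leastInOrbit τ τ-inj)
    where σ = insertMax τ c

-- Every permutation of n + 1 elements is exactly one insertion

skipMax : ∀ {n} → Vec (Fin (suc n)) (suc n) → Fin (suc n) → Fin (suc n)
skipMax {n} σ x with lookup σ x Fin.≟ fromℕ n
... | yes _ = lookup σ (fromℕ n)
... | no  _ = lookup σ x

module _ {n} (σ : Vec (Fin (suc n)) (suc n)) where

  skipMax-hit : ∀ {x} → lookup σ x ≡ fromℕ n → skipMax σ x ≡ lookup σ (fromℕ n)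
  skipMax-hit {x} σx≡n with lookup σ x Fin.≟ fromℕ n
  ... | yes _   = refl
  ... | no σx≢n = ⊥-elim (σx≢n σx≡n)

  skipMax-miss : ∀ {x} → lookup σ x ≢ fromℕ n → skipMax σ x ≡ lookup σ x
  skipMax-miss {x} σx≢n with lookup σ x Fin.≟ fromℕ n
  ... | yes σx≡n = ⊥-elim (σx≢n σx≡n)
  ... | no _     = refl

  module _ (σ-inj : Injective σ) where

    skipMax-old≢max : ∀ y → skipMax σ (inject₁ y) ≢ fromℕ n
    skipMax-old≢max y with lookup σ (inject₁ y) Fin.≟ fromℕ n
    ... | yes σy≡n = λ σn≡n → fromℕ≢inject₁ (σ-inj _ _ (trans σn≡n (sym σy≡n)))
    ... | no σy≢n  = σy≢n

    skipMax-old-injective : ∀ y y′ → skipMax σ (inject₁ y) ≡ skipMax σ (inject₁ y′) → y ≡ y′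
    skipMax-old-injective y y′ eq with lookup σ (inject₁ y) Fin.≟ fromℕ n | lookup σ (inject₁ y′) Fin.≟ fromℕ n
    ... | yes σy≡n | yes σy′≡n = inject₁-injective (σ-inj _ _ (trans σy≡n (sym σy′≡n)))
    ... | yes _    | no _      = ⊥-elim (fromℕ≢inject₁ (σ-inj _ _ eq))
    ... | no _     | yes _     = ⊥-elim (fromℕ≢inject₁ (σ-inj _ _ (sym eq)))
    ... | no _     | no _      = inject₁-injective (σ-inj _ _ eq)

    removeMax : Vec (Fin n) n
    removeMax = tabulate (λ y → lower₁ (skipMax σ (inject₁ y)) (skipMax-old≢max y ∘ ≡fromℕ))
      where
      ≡fromℕ : ∀ {x} → n ≡ toℕ x → x ≡ fromℕ n
      ≡fromℕ eq = toℕ-injective (trans (sym eq) (sym (toℕ-fromℕ n)))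

    inject₁-removeMax : ∀ y → inject₁ (lookup removeMax y) ≡ skipMax σ (inject₁ y)
    inject₁-removeMax y = trans (cong inject₁ (lookup∘tabulate _ y)) (inject₁-lower₁ _ _)

    removeMax-injective : Injective removeMax
    removeMax-injective y y′ eq = skipMax-old-injective y y′
      (trans (sym (inject₁-removeMax y)) (trans (cong inject₁ eq) (inject₁-removeMax y′)))

    insertMax-removeMax : ∀ {p} → lookup σ p ≡ fromℕ n → ∃[ c ] insertMax removeMax c ≡ σ
    insertMax-removeMax {p} σp≡n with view p
    ... | ‵fromℕ = zero , lookup-ext pointwise
      where
      pointwise : ∀ x → lookup (insertMax removeMax zero) x ≡ lookup σ x
      pointwise x with view x
      ... | ‵fromℕ     = trans (insertMax-max-zero removeMax) (sym σp≡n)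
      ... | ‵inject₁ y = trans (insertMax-old removeMax zero y (λ ())) (trans (inject₁-removeMax y) (skipMax-miss σy≢n))
        where σy≢n = λ σy≡n → fromℕ≢inject₁ (σ-inj _ _ (trans σp≡n (sym σy≡n)))
    ... | ‵inject₁ j = suc j , lookup-ext pointwise
      where
      pointwise : ∀ x → lookup (insertMax removeMax (suc j)) x ≡ lookup σ x
      pointwise x with view x
      ... | ‵fromℕ     = trans (insertMax-max-suc removeMax j) (trans (inject₁-removeMax j) (skipMax-hit σp≡n))
      ... | ‵inject₁ y with y Fin.≟ j
      ...   | yes refl = trans (insertMax-at removeMax j) (sym σp≡n)
      ...   | no y≢j   = trans (insertMax-old removeMax (suc j) y (y≢j ∘ sym ∘ suc-injective))
                           (trans (inject₁-removeMax y) (skipMax-miss σy≢n))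
        where σy≢n = λ σy≡n → y≢j (inject₁-injective (σ-inj _ _ (trans σy≡n (sym σp≡n))))

insertMax-surjective : ∀ {n} (σ : Vec (Fin (suc n)) (suc n)) → Injective σ →
                       ∃[ τ ] ∃[ c ] Injective τ × insertMax τ c ≡ σ
insertMax-surjective {n} σ σ-inj with iter-period σ σ-inj (fromℕ n)
... | _ , _ , σp≡n with insertMax-removeMax σ σ-inj σp≡n
...   | c , eq = removeMax σ σ-inj , c , removeMax-injective σ σ-inj , eq

skipMax-insertMax : ∀ {n} (τ : Vec (Fin n) n) c y → skipMax (insertMax τ c) (inject₁ y) ≡ inject₁ (lookup τ y)
skipMax-insertMax τ c y with insertMax-step τ c y
... | inj₁ σy≡τy          =
  trans (skipMax-miss (insertMax τ c) (λ σy≡n → fromℕ≢inject₁ (trans (sym σy≡n) σy≡τy))) σy≡τy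
... | inj₂ (σy≡n , σn≡τy) = trans (skipMax-hit (insertMax τ c) σy≡n) σn≡τy

insertMax-injective₂ : ∀ {n} {τ τ′ : Vec (Fin n) n} {c c′} →
                       insertMax τ c ≡ insertMax τ′ c′ → τ ≡ τ′ × c ≡ c′
insertMax-injective₂ {n} {τ} {τ′} {c} {c′} eq = lookup-ext same-τ , same-c c c′ eq
  where
  same-τ : ∀ y → lookup τ y ≡ lookup τ′ y
  same-τ y = inject₁-injective (begin
    inject₁ (lookup τ y)                  ≡⟨ skipMax-insertMax τ c y ⟨
    skipMax (insertMax τ c) (inject₁ y)   ≡⟨ cong (λ σ → skipMax σ (inject₁ y)) eq ⟩
    skipMax (insertMax τ′ c′) (inject₁ y) ≡⟨ skipMax-insertMax τ′ c′ y ⟩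
    inject₁ (lookup τ′ y)                 ∎)
    where open ≡-Reasoning
  same-c : ∀ c c′ → insertMax τ c ≡ insertMax τ′ c′ → c ≡ c′
  same-c c       (suc j′) eq =
    insertMax-hits-max τ c j′ (trans (cong (λ σ → lookup σ (inject₁ j′)) eq) (insertMax-at τ′ j′))
  same-c zero    zero     eq = refl
  same-c (suc j) zero     eq = ⊥-elim (fromℕ≢inject₁
    (trans (sym (insertMax-max-zero τ′)) (trans (cong (λ σ → lookup σ (fromℕ n)) (sym eq)) (insertMax-max-suc τ j))))

concatMap-map≡cartesianProductWith : ∀ {A B C : Set} (f : A → B → C) xs ys →
                                     concatMap (λ x → List.map (f x) ys) xs ≡ cartesianProductWith f xs ys
concatMap-map≡cartesianProductWith f []       ys = refl
concatMap-map≡cartesianProductWith f (x ∷ xs) ys =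
  cong (List.map (f x) ys ++_) (concatMap-map≡cartesianProductWith f xs ys)

allVecs-unique : ∀ {A : Set} n {xs : List A} → Unique xs → Unique (allVecs n xs)
allVecs-unique zero            _   = [] ∷ []
allVecs-unique (suc n) {xs} xs! = subst Unique (sym (concatMap-map≡cartesianProductWith _∷_ xs (allVecs n xs)))
  (cartesianProductWith⁺ _∷_ ∷-injective xs! (allVecs-unique n xs!))

∈-allVecs : ∀ {A : Set} {n} {xs : List A} → (∀ x → x ∈ xs) → (v : Vec A n) → v ∈ allVecs n xs
∈-allVecs complete []                             = here refl
∈-allVecs {n = suc n} {xs} complete (x ∷ v) =
  subst (x ∷ v ∈_) (sym (concatMap-map≡cartesianProductWith _∷_ xs (allVecs n xs)))
    (∈-cartesianProductWith⁺ _∷_ (complete x) (∈-allVecs complete v))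

perms-unique : ∀ n → Unique (perms n)
perms-unique n = filter⁺ injective? (allVecs-unique n (allFin⁺ n))

∈-perms⁺ : ∀ {n} {σ : Vec (Fin n) n} → Injective σ → σ ∈ perms n
∈-perms⁺ {n} {σ} σ-inj = ∈-filter⁺ injective? (∈-allVecs ∈-allFin σ) σ-inj

∈-perms⁻ : ∀ {n} {σ : Vec (Fin n) n} → σ ∈ perms n → Injective σ
∈-perms⁻ {n} σ∈ = proj₂ (∈-filter⁻ injective? {xs = allMaps n n} σ∈)

insertions : ∀ n → List (Vec (Fin (suc n)) (suc n))
insertions n = cartesianProductWith insertMax (perms n) (allFin (suc n))

perms-suc↭insertions : ∀ n → perms (suc n) ↭ insertions n
perms-suc↭insertions n = ∼bag⇒↭ (unique∧set⇒bag (perms-unique (suc n)) insertions-unique (mk⇔ to from))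
  where
  insertions-unique : Unique (insertions n)
  insertions-unique = cartesianProductWith⁺ insertMax insertMax-injective₂ (perms-unique n) (allFin⁺ (suc n))
  to : ∀ {σ} → σ ∈ perms (suc n) → σ ∈ insertions n
  to {σ} σ∈ with insertMax-surjective σ (∈-perms⁻ σ∈)
  ... | τ , c , τ-inj , refl = ∈-cartesianProductWith⁺ insertMax (∈-perms⁺ τ-inj) (∈-allFin c)
  from : ∀ {σ} → σ ∈ insertions n → σ ∈ perms (suc n)
  from σ∈ with ∈-cartesianProductWith⁻ insertMax (perms n) (allFin (suc n)) σ∈
  ... | τ , c , τ∈ , _ , refl = ∈-perms⁺ (insertMax-injective τ (∈-perms⁻ τ∈) c)

-- The recurrence of the Stirling numbers of the first kind

module _ where
  open Sums ℕ.+-*-commutativeSemiring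
  open import Data.Nat using (_+_; _*_)

  length-filter≡∑𝟙 : ∀ {X : Set} {p} {P : Pred X p} (P? : Decidable P) xs →
                     length (filter P? xs) ≡ ∑ (𝟙 ∘ P?) xs
  length-filter≡∑𝟙 P? []       = refl
  length-filter≡∑𝟙 P? (x ∷ xs) with does (P? x)
  ... | true  = cong suc (length-filter≡∑𝟙 P? xs)
  ... | false = length-filter≡∑𝟙 P? xs

  ∑-const : ∀ {X : Set} (a : ℕ) (xs : List X) → ∑ (λ _ → a) xs ≡ length xs * a
  ∑-const a []       = refl
  ∑-const a (x ∷ xs) = cong (_+_ a) (∑-const a xs)

  cycles-insertMax : ∀ {n} (τ : Vec (Fin n) n) → Injective τ → ∀ c →
                     cycles (insertMax τ c) ≡ 𝟙 (c Fin.≟ zero) + cycles τ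
  cycles-insertMax {n} τ τ-inj c = begin
    cycles σ
      ≡⟨ length-filter≡∑𝟙 (cycleMin? σ) (allFin (suc n)) ⟩
    ∑ (𝟙 ∘ cycleMin? σ) (allFin (suc n))
      ≡⟨ ∑-allFin-init-last (𝟙 ∘ cycleMin? σ) ⟩
    ∑ (𝟙 ∘ cycleMin? σ ∘ inject₁) (allFin n) + 𝟙 (cycleMin? σ (fromℕ n))
      ≡⟨ cong₂ _+_ (∑-cong old (allFin n)) max ⟩
    ∑ (𝟙 ∘ cycleMin? τ) (allFin n) + 𝟙 (c Fin.≟ zero)
      ≡⟨ cong (_+ 𝟙 (c Fin.≟ zero)) (length-filter≡∑𝟙 (cycleMin? τ) (allFin n)) ⟨
    cycles τ + 𝟙 (c Fin.≟ zero)
      ≡⟨ ℕ.+-comm (cycles τ) _ ⟩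
    𝟙 (c Fin.≟ zero) + cycles τ
      ∎
    where
    open ≡-Reasoning
    σ = insertMax τ c
    old : ∀ y → 𝟙 (cycleMin? σ (inject₁ y)) ≡ 𝟙 (cycleMin? τ y)
    old y = 𝟙-⇔ (cycleMin-insertMax-old τ τ-inj c y) (cycleMin? σ (inject₁ y)) (cycleMin? τ y)
    max : 𝟙 (cycleMin? σ (fromℕ n)) ≡ 𝟙 (c Fin.≟ zero)
    max = 𝟙-⇔ (cycleMin-insertMax-max τ c) (cycleMin? σ (fromℕ n)) (c Fin.≟ zero)

  ∑-cycles-insertMax : ∀ {n} (τ : Vec (Fin n) n) → Injective τ → ∀ k →
                       ∑[ c ← allFin (suc n) ] 𝟙 (cycles (insertMax τ c) ℕ.≟ k)
                       ≡ 𝟙 (suc (cycles τ) ℕ.≟ k) + n * 𝟙 (cycles τ ℕ.≟ k)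
  ∑-cycles-insertMax {n} τ τ-inj k = begin
    ∑[ c ← allFin (suc n) ] 𝟙 (cycles (insertMax τ c) ℕ.≟ k)
      ≡⟨ ∑-allFin-suc (λ c → 𝟙 (cycles (insertMax τ c) ℕ.≟ k)) ⟩
    𝟙 (cycles (insertMax τ zero) ℕ.≟ k) + ∑[ j ← allFin n ] 𝟙 (cycles (insertMax τ (suc j)) ℕ.≟ k)
      ≡⟨ cong₂ _+_ (cong (𝟙 ∘ (ℕ._≟ k)) (cycles-insertMax τ τ-inj zero))
                   (∑-cong (λ j → cong (𝟙 ∘ (ℕ._≟ k)) (cycles-insertMax τ τ-inj (suc j))) (allFin n)) ⟩
    𝟙 (suc (cycles τ) ℕ.≟ k) + ∑[ j ← allFin n ] 𝟙 (cycles τ ℕ.≟ k)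
      ≡⟨ cong (_+_ (𝟙 (suc (cycles τ) ℕ.≟ k)))
              (trans (∑-const _ (allFin n)) (cong (_* 𝟙 (cycles τ ℕ.≟ k)) (length-tabulate {n = n} (λ i → i)))) ⟩
    𝟙 (suc (cycles τ) ℕ.≟ k) + n * 𝟙 (cycles τ ℕ.≟ k)
      ∎
    where open ≡-Reasoning

  stirling1-suc : ∀ n k → stirling1 (suc n) k ≡ n * stirling1 n k + ∑[ τ ← perms n ] 𝟙 (suc (cycles τ) ℕ.≟ k)
  stirling1-suc n k = begin
    length (filter P? (perms (suc n)))
      ≡⟨ ↭-length (filter-↭ P? (perms-suc↭insertions n)) ⟩
    length (filter P? (insertions n))
      ≡⟨ length-filter≡∑𝟙 P? (insertions n) ⟩
    ∑ (𝟙 ∘ P?) (cartesianProductWith insertMax (perms n) (allFin (suc n)))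
      ≡⟨ cong (∑ (𝟙 ∘ P?)) (concatMap-map≡cartesianProductWith insertMax (perms n) (allFin (suc n))) ⟨
    ∑ (𝟙 ∘ P?) (concatMap (λ τ → List.map (insertMax τ) (allFin (suc n))) (perms n))
      ≡⟨ ∑-concatMap (𝟙 ∘ P?) _ (perms n) ⟩
    ∑[ τ ← perms n ] ∑ (𝟙 ∘ P?) (List.map (insertMax τ) (allFin (suc n)))
      ≡⟨ ∑-cong-∈ (perms n) (λ {τ} τ∈ → trans (∑-map (𝟙 ∘ P?) (insertMax τ) (allFin (suc n)))
                                              (∑-cycles-insertMax τ (∈-perms⁻ τ∈) k)) ⟩
    ∑[ τ ← perms n ] (𝟙 (suc (cycles τ) ℕ.≟ k) + n * 𝟙 (P? τ))
      ≡⟨ ∑-+ _ _ (perms n) ⟩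
    ∑[ τ ← perms n ] 𝟙 (suc (cycles τ) ℕ.≟ k) + ∑[ τ ← perms n ] (n * 𝟙 (P? τ))
      ≡⟨ cong (_+_ (∑[ τ ← perms n ] 𝟙 (suc (cycles τ) ℕ.≟ k)))
              (trans (sym (∑-*ˡ n (𝟙 ∘ P?) (perms n))) (cong (n *_) (sym (length-filter≡∑𝟙 P? (perms n))))) ⟩
    ∑[ τ ← perms n ] 𝟙 (suc (cycles τ) ℕ.≟ k) + n * stirling1 n k
      ≡⟨ ℕ.+-comm (∑[ τ ← perms n ] 𝟙 (suc (cycles τ) ℕ.≟ k)) _ ⟩
    n * stirling1 n k + ∑[ τ ← perms n ] 𝟙 (suc (cycles τ) ℕ.≟ k)
      ∎
    where
    open ≡-Reasoning
    P? : ∀ {m} (σ : Vec (Fin m) m) → Dec (cycles σ ≡ k)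
    P? σ = cycles σ ℕ.≟ k

  -- 𝟙 (suc c ℕ.≟ suc k) and 𝟙 (c ℕ.≟ k) are definitionally equal.
  stirling1-suc-suc : ∀ n k → stirling1 (suc n) (suc k) ≡ n * stirling1 n (suc k) + stirling1 n k
  stirling1-suc-suc n k =
    trans (stirling1-suc n (suc k)) (cong (_+_ (n * stirling1 n (suc k))) (sym (length-filter≡∑𝟙 _ (perms n))))

  stirling1-suc-zero : ∀ n → stirling1 (suc n) zero ≡ 0
  stirling1-suc-zero zero    = refl
  stirling1-suc-zero (suc n) = begin
    stirling1 (suc (suc n)) zero
      ≡⟨ stirling1-suc (suc n) zero ⟩
    suc n * stirling1 (suc n) zero + ∑[ τ ← perms (suc n) ] 0
      ≡⟨ cong₂ _+_ (cong (suc n *_) (stirling1-suc-zero n)) (∑-zero (perms (suc n))) ⟩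
    suc n * 0 + 0
      ≡⟨ cong (_+ 0) (ℕ.*-zeroʳ (suc n)) ⟩
    0 ∎
    where open ≡-Reasoning

  stirling1-vanish : ∀ {n k} → n < k → stirling1 n k ≡ 0
  stirling1-vanish {zero}  {suc k} _         = refl
  stirling1-vanish {suc n} {suc k} (s≤s n<k) = begin
    stirling1 (suc n) (suc k)
      ≡⟨ stirling1-suc-suc n k ⟩
    n * stirling1 n (suc k) + stirling1 n k
      ≡⟨ cong₂ (λ a b → n * a + b) (stirling1-vanish (ℕ.m<n⇒m<1+n n<k)) (stirling1-vanish n<k) ⟩
    n * 0 + 0
      ≡⟨ cong (_+ 0) (ℕ.*-zeroʳ n) ⟩
    0 ∎
    where open ≡-Reasoning

-- Increasing trees with a given pruning

open Sums ℤ.+-*-commutativeSemiring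
open import Data.Integer using (+_; -_; _+_; _*_; _^_)

countBelow : ∀ {m} → Subset m → Fin m → ℕ
countBelow (b ∷ S)     zero    = 0
countBelow (b ∷ S)     (suc v) = if b then suc (countBelow S v) else countBelow S v

-- Non-root vertex v : Fin m carries label v + 2, and a parent p : Fin (suc m) is a 0-based label.
-- In an increasing tree with pruning S, v may hang from the root, from any of the v smaller
-- non-root vertices if v ∉ S, and only from those in S if v ∈ S.
parentCount : ∀ {m} → Subset m → Fin m → ℕ
parentCount S v = suc (if lookup S v then countBelow S v else toℕ v)

treesWithPruning : ∀ {m} → Subset m → ℤ
treesWithPruning S = ∏[ v ] (+ parentCount S v)

∑-countBelow : ∀ {m} (S : Subset m) v →
               ∑[ w ← allFin m ] (𝟙 (suc (toℕ w) ℕ.≤? toℕ v) * 𝟙 (w ∈? S)) ≡ + countBelow S v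
∑-countBelow {m}     (b ∷ S)     zero    = ∑-zero (allFin m)
∑-countBelow {suc m} (true ∷ S)  (suc v) =
  trans (∑-allFin-suc {m} (λ w → 𝟙 (suc (toℕ w) ℕ.≤? suc (toℕ v)) * 𝟙 (w ∈? (true ∷ S))))
        (cong (_+_ (+ 1)) (∑-countBelow S v))
∑-countBelow {suc m} (false ∷ S) (suc v) =
  trans (∑-allFin-suc {m} (λ w → 𝟙 (suc (toℕ w) ℕ.≤? suc (toℕ v)) * 𝟙 (w ∈? (false ∷ S))))
        (cong (_+_ (+ 0)) (∑-countBelow S v))

∑-below : ∀ {m} (v : Fin m) → ∑[ w ← allFin m ] 𝟙 (suc (toℕ w) ℕ.≤? toℕ v) ≡ + toℕ v
∑-below {m}     zero    = ∑-zero (allFin m)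
∑-below {suc m} (suc v) =
  trans (∑-allFin-suc {m} (λ w → 𝟙 (suc (toℕ w) ℕ.≤? suc (toℕ v)))) (cong (_+_ (+ 1)) (∑-below v))

∑-admissibleParents : ∀ {m} (S : Subset m) v →
  ∑[ p ← allFin (suc m) ] (𝟙 (toℕ p ℕ.≤? toℕ v) * 𝟙 ((v ∈? S) →-dec parentOk? S p)) ≡ + parentCount S v
∑-admissibleParents {m} S v =
  trans (∑-allFin-suc {m} (λ p → 𝟙 (toℕ p ℕ.≤? toℕ v) * 𝟙 ((v ∈? S) →-dec parentOk? S p)))
        (cong₂ _+_ root nonRoot)
  where
  root : 𝟙 (0 ℕ.≤? toℕ v) * 𝟙 ((v ∈? S) →-dec parentOk? S zero) ≡ + 1
  root = cong (_*_ (+ 1)) (𝟙-yes (λ _ → tt) ((v ∈? S) →-dec parentOk? S zero))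
  nonRoot : ∑[ w ← allFin m ] (𝟙 (suc (toℕ w) ℕ.≤? toℕ v) * 𝟙 ((v ∈? S) →-dec (w ∈? S)))
          ≡ + (if lookup S v then countBelow S v else toℕ v)
  nonRoot with lookup S v in Sv
  ... | true  = trans (∑-cong (λ w → cong (𝟙 (suc (toℕ w) ℕ.≤? toℕ v) *_)
                                         (𝟙-⇔ (mk⇔ (λ f → f v∈S) (λ w∈S _ → w∈S)) ((v ∈? S) →-dec (w ∈? S)) (w ∈? S)))
                              (allFin m))
                      (∑-countBelow S v)
    where v∈S = lookup⇒[]= v S Sv
  ... | false = trans (∑-cong (λ w → trans (cong (𝟙 (suc (toℕ w) ℕ.≤? toℕ v) *_)
                                                (𝟙-yes (λ v∈S → ⊥-elim (v∉S v∈S)) ((v ∈? S) →-dec (w ∈? S))))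
                                         (ℤ.*-identityʳ _))
                              (allFin m))
                      (∑-below v)
    where
    v∉S : ¬ v ∈ₛ S
    v∉S v∈S with () ← trans (sym Sv) ([]=⇒lookup v∈S)

count-trees-with-pruning : ∀ m (S : Subset m) →
  ∑[ T ← allMaps m (suc m) ] (𝟙 (isIncreasing? T) * 𝟙 (isPruning? T S)) ≡ treesWithPruning S
count-trees-with-pruning m S = begin
  ∑[ T ← allMaps m (suc m) ] (𝟙 (isIncreasing? T) * 𝟙 (isPruning? T S))
    ≡⟨ ∑-cong (λ T → trans (cong₂ _*_ (𝟙-all? (λ v → toℕ (lookup T v) ℕ.≤? toℕ v))
                                        (𝟙-all? (λ v → (v ∈? S) →-dec parentOk? S (lookup T v))))
                            (sym (∏-distrib (λ v → 𝟙 (toℕ (lookup T v) ℕ.≤? toℕ v))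
                                            (λ v → 𝟙 ((v ∈? S) →-dec parentOk? S (lookup T v))))))
              (allMaps m (suc m)) ⟩
  ∑[ T ← allMaps m (suc m) ] ∏[ v ] admissible v (lookup T v)
    ≡⟨ ∑-allVecs-∏ m (allFin (suc m)) admissible ⟩
  ∏[ v ] ∑ (admissible v) (allFin (suc m))
    ≡⟨ ∏-cong (∑-admissibleParents S) ⟩
  treesWithPruning S
    ∎
  where
  open ≡-Reasoning
  admissible : Fin m → Fin (suc m) → ℤ
  admissible v p = 𝟙 (toℕ p ℕ.≤? toℕ v) * 𝟙 ((v ∈? S) →-dec parentOk? S p)

subsets : ∀ m → List (Subset m)
subsets m = allVecs m (inside ∷ outside ∷ [])

rhs15≡∑-subsets : ∀ m → rhs15 m ≡ ∑[ S ← subsets m ] ((- (+ 1)) ^ ∣ S ∣ * treesWithPruning S)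
rhs15≡∑-subsets m = begin
  ∑[ T ← filter isIncreasing? Ts ] ∑[ S ← filter (isPruning? T) (subsets m) ] sign S
    ≡⟨ ∑-filter isIncreasing? _ Ts ⟩
  ∑[ T ← Ts ] (𝟙 (isIncreasing? T) * ∑[ S ← filter (isPruning? T) (subsets m) ] sign S)
    ≡⟨ ∑-cong (λ T → cong (𝟙 (isIncreasing? T) *_) (∑-filter (isPruning? T) sign (subsets m))) Ts ⟩
  ∑[ T ← Ts ] (𝟙 (isIncreasing? T) * ∑[ S ← subsets m ] (𝟙 (isPruning? T S) * sign S))
    ≡⟨ ∑-cong (λ T → ∑-*ˡ (𝟙 (isIncreasing? T)) _ (subsets m)) Ts ⟩
  ∑[ T ← Ts ] ∑[ S ← subsets m ] (𝟙 (isIncreasing? T) * (𝟙 (isPruning? T S) * sign S))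
    ≡⟨ ∑-comm _ Ts (subsets m) ⟩
  ∑[ S ← subsets m ] ∑[ T ← Ts ] (𝟙 (isIncreasing? T) * (𝟙 (isPruning? T S) * sign S))
    ≡⟨ ∑-cong (λ S → trans (∑-cong (λ T → sym (ℤ.*-assoc (𝟙 (isIncreasing? T)) (𝟙 (isPruning? T S)) (sign S))) Ts)
                           (sym (∑-*ʳ (sign S) (λ T → 𝟙 (isIncreasing? T) * 𝟙 (isPruning? T S)) Ts)))
              (subsets m) ⟩
  ∑[ S ← subsets m ] (∑[ T ← Ts ] (𝟙 (isIncreasing? T) * 𝟙 (isPruning? T S)) * sign S)
    ≡⟨ ∑-cong (λ S → trans (cong (_* sign S) (count-trees-with-pruning m S)) (ℤ.*-comm _ (sign S))) (subsets m) ⟩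
  ∑[ S ← subsets m ] (sign S * treesWithPruning S)
    ∎
  where
  open ≡-Reasoning
  Ts = allMaps m (suc m)
  sign : Subset m → ℤ
  sign S = (- (+ 1)) ^ ∣ S ∣

-- Removing the last vertex

∣∷ʳinside∣ : ∀ {m} (S : Subset m) → ∣ S Vec.∷ʳ inside ∣ ≡ suc ∣ S ∣
∣∷ʳinside∣ []          = refl
∣∷ʳinside∣ (true ∷ S)  = cong suc (∣∷ʳinside∣ S)
∣∷ʳinside∣ (false ∷ S) = ∣∷ʳinside∣ S

∣∷ʳoutside∣ : ∀ {m} (S : Subset m) → ∣ S Vec.∷ʳ outside ∣ ≡ ∣ S ∣
∣∷ʳoutside∣ []          = refl
∣∷ʳoutside∣ (true ∷ S)  = cong suc (∣∷ʳoutside∣ S)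
∣∷ʳoutside∣ (false ∷ S) = ∣∷ʳoutside∣ S

countBelow-∷ʳ-inject₁ : ∀ {m} (S : Subset m) b v → countBelow (S Vec.∷ʳ b) (inject₁ v) ≡ countBelow S v
countBelow-∷ʳ-inject₁ (x ∷ S)     b zero    = refl
countBelow-∷ʳ-inject₁ (true ∷ S)  b (suc v) = cong suc (countBelow-∷ʳ-inject₁ S b v)
countBelow-∷ʳ-inject₁ (false ∷ S) b (suc v) = countBelow-∷ʳ-inject₁ S b v

countBelow-∷ʳ-fromℕ : ∀ {m} (S : Subset m) b → countBelow (S Vec.∷ʳ b) (fromℕ m) ≡ ∣ S ∣
countBelow-∷ʳ-fromℕ []          b = refl
countBelow-∷ʳ-fromℕ (true ∷ S)  b = cong suc (countBelow-∷ʳ-fromℕ S b)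
countBelow-∷ʳ-fromℕ (false ∷ S) b = countBelow-∷ʳ-fromℕ S b

parentCount-∷ʳ-inject₁ : ∀ {m} (S : Subset m) b v → parentCount (S Vec.∷ʳ b) (inject₁ v) ≡ parentCount S v
parentCount-∷ʳ-inject₁ S b v
  rewrite lookup-∷ʳ-inject₁ S b v | countBelow-∷ʳ-inject₁ S b v | toℕ-inject₁ v = refl

parentCount-∷ʳ-fromℕ : ∀ {m} (S : Subset m) b →
                       parentCount (S Vec.∷ʳ b) (fromℕ m) ≡ suc (if b then ∣ S ∣ else m)
parentCount-∷ʳ-fromℕ {m} S b
  rewrite lookup-∷ʳ-fromℕ S b | countBelow-∷ʳ-fromℕ S b | toℕ-fromℕ m = refl

treesWithPruning-∷ʳ : ∀ {m} (S : Subset m) b →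
                      treesWithPruning (S Vec.∷ʳ b) ≡ treesWithPruning S * + suc (if b then ∣ S ∣ else m)
treesWithPruning-∷ʳ S b = trans (∏-init-last (λ v → + parentCount (S Vec.∷ʳ b) v))
  (cong₂ _*_ (∏-cong (cong +_ ∘ parentCount-∷ʳ-inject₁ S b)) (cong +_ (parentCount-∷ʳ-fromℕ S b)))

weightedSubsetSum : ℕ → (ℕ → ℤ) → ℤ
weightedSubsetSum m g = ∑[ S ← subsets m ] (g ∣ S ∣ * treesWithPruning S)

weightedStirlingSum : ℕ → (ℕ → ℤ) → ℤ
weightedStirlingSum m g = ∑[ j ← upTo (suc m) ] (g j * + (j ! ℕ.* stirling1 (suc m) (suc j)))

-- The weight seen by S ⊆ {0,…,m-1} once vertex m is summed out: m ∈ S adds |S| + 1 parents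
-- and one element, m ∉ S adds m + 1 parents.
peel : ℕ → (ℕ → ℤ) → ℕ → ℤ
peel m g j = g (suc j) * + suc j + g j * + suc m

weightedSubsetSum-suc : ∀ m g → weightedSubsetSum (suc m) g ≡ weightedSubsetSum m (peel m g)
weightedSubsetSum-suc m g = trans (∑-allVecs-∷ʳ m (inside ∷ outside ∷ []) (λ S → g ∣ S ∣ * treesWithPruning S))
                                  (∑-cong lastVertex (subsets m))
  where
  lastVertex : ∀ S → g ∣ S Vec.∷ʳ inside ∣ * treesWithPruning (S Vec.∷ʳ inside)
                     + (g ∣ S Vec.∷ʳ outside ∣ * treesWithPruning (S Vec.∷ʳ outside) + + 0)
                   ≡ peel m g ∣ S ∣ * treesWithPruning S
  lastVertex S
    rewrite ∣∷ʳinside∣ S | ∣∷ʳoutside∣ S | treesWithPruning-∷ʳ S inside | treesWithPruning-∷ʳ S outside =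
    solve 5 (λ a b t s M → a :* (t :* s) :+ (b :* (t :* M) :+ con (+ 0)) := (a :* s :+ b :* M) :* t)
          refl (g (suc ∣ S ∣)) (g ∣ S ∣) (treesWithPruning S) (+ suc ∣ S ∣) (+ suc m)
    where open +-*-Solver

weightedStirlingSum-suc : ∀ m g → weightedStirlingSum (suc m) g ≡ weightedStirlingSum m (peel m g)
weightedStirlingSum-suc m g = begin
  ∑[ j ← upTo (suc (suc m)) ] (g j * + (j ! ℕ.* stirling1 (suc (suc m)) (suc j)))
    ≡⟨ ∑-cong split (upTo (suc (suc m))) ⟩
  ∑[ j ← upTo (suc (suc m)) ] (g j * + suc m * a j + g j * b j)
    ≡⟨ ∑-+ (λ j → g j * + suc m * a j) (λ j → g j * b j) (upTo (suc (suc m))) ⟩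
  ∑[ j ← upTo (suc (suc m)) ] (g j * + suc m * a j) + ∑[ j ← upTo (suc (suc m)) ] (g j * b j)
    ≡⟨ cong₂ _+_ drop-last drop-first ⟩
  ∑[ j ← upTo (suc m) ] (g j * + suc m * a j) + ∑[ j ← upTo (suc m) ] (g (suc j) * + suc j * a j)
    ≡⟨ ℤ.+-comm (∑[ j ← upTo (suc m) ] (g j * + suc m * a j)) _ ⟩
  ∑[ j ← upTo (suc m) ] (g (suc j) * + suc j * a j) + ∑[ j ← upTo (suc m) ] (g j * + suc m * a j)
    ≡⟨ ∑-+ (λ j → g (suc j) * + suc j * a j) (λ j → g j * + suc m * a j) (upTo (suc m)) ⟨
  ∑[ j ← upTo (suc m) ] (g (suc j) * + suc j * a j + g j * + suc m * a j)
    ≡⟨ ∑-cong (λ j → sym (ℤ.*-distribʳ-+ (a j) (g (suc j) * + suc j) (g j * + suc m))) (upTo (suc m)) ⟩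
  weightedStirlingSum m (peel m g)
    ∎
  where
  open ≡-Reasoning
  a b : ℕ → ℤ
  a j = + (j ! ℕ.* stirling1 (suc m) (suc j))
  b j = + (j ! ℕ.* stirling1 (suc m) j)

  split : ∀ j → g j * + (j ! ℕ.* stirling1 (suc (suc m)) (suc j)) ≡ g j * + suc m * a j + g j * b j
  split j = begin
    g j * + (j ! ℕ.* stirling1 (suc (suc m)) (suc j))
      ≡⟨ cong (λ c → g j * + (j ! ℕ.* c)) (stirling1-suc-suc (suc m) j) ⟩
    g j * + (j ! ℕ.* (suc m ℕ.* c₁ ℕ.+ c₀))
      ≡⟨ cong (λ z → g j * + z) reassociate ⟩
    g j * + (suc m ℕ.* (j ! ℕ.* c₁) ℕ.+ j ! ℕ.* c₀)
      ≡⟨ cong (g j *_) (trans (ℤ.pos-+ (suc m ℕ.* (j ! ℕ.* c₁)) (j ! ℕ.* c₀))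
                              (cong (_+ b j) (ℤ.pos-* (suc m) (j ! ℕ.* c₁)))) ⟩
    g j * (+ suc m * a j + b j)
      ≡⟨ trans (ℤ.*-distribˡ-+ (g j) _ _) (cong (_+ g j * b j) (sym (ℤ.*-assoc (g j) _ _))) ⟩
    g j * + suc m * a j + g j * b j
      ∎
    where
    c₁ = stirling1 (suc m) (suc j)
    c₀ = stirling1 (suc m) j
    reassociate : j ! ℕ.* (suc m ℕ.* c₁ ℕ.+ c₀) ≡ suc m ℕ.* (j ! ℕ.* c₁) ℕ.+ j ! ℕ.* c₀
    reassociate = solve 4 (λ f M x y → f :* (M :* x :+ y) := M :* (f :* x) :+ f :* y) refl (j !) (suc m) c₁ c₀
      where open ℕ-Solver

  drop-last : ∑[ j ← upTo (suc (suc m)) ] (g j * + suc m * a j) ≡ ∑[ j ← upTo (suc m) ] (g j * + suc m * a j)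
  drop-last = trans (∑-upTo-∷ʳ (λ j → g j * + suc m * a j) (suc m))
                    (trans (cong (_+_ (∑[ j ← upTo (suc m) ] (g j * + suc m * a j))) last≡0) (ℤ.+-identityʳ _))
    where
    last≡0 : g (suc m) * + suc m * a (suc m) ≡ + 0
    last≡0 rewrite stirling1-vanish (ℕ.n<1+n (suc m)) | ℕ.*-zeroʳ (suc m !) = ℤ.*-zeroʳ (g (suc m) * + suc m)

  drop-first : ∑[ j ← upTo (suc (suc m)) ] (g j * b j) ≡ ∑[ j ← upTo (suc m) ] (g (suc j) * + suc j * a j)
  drop-first = trans (∑-upTo-suc (λ j → g j * b j) (suc m))
                     (trans (cong₂ _+_ first≡0 (∑-cong shift (upTo (suc m)))) (ℤ.+-identityˡ _))
    where
    first≡0 : g 0 * b 0 ≡ + 0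
    first≡0 rewrite stirling1-suc-zero m = ℤ.*-zeroʳ (g 0)
    shift : ∀ j → g (suc j) * b (suc j) ≡ g (suc j) * + suc j * a j
    shift j = trans (cong (λ z → g (suc j) * + z) (ℕ.*-assoc (suc j) (j !) _))
                    (trans (cong (g (suc j) *_) (ℤ.pos-* (suc j) _)) (sym (ℤ.*-assoc (g (suc j)) _ _)))

weightedSubsetSum≡weightedStirlingSum : ∀ m g → weightedSubsetSum m g ≡ weightedStirlingSum m g
weightedSubsetSum≡weightedStirlingSum zero    g = refl
weightedSubsetSum≡weightedStirlingSum (suc m) g = begin
  weightedSubsetSum (suc m) g        ≡⟨ weightedSubsetSum-suc m g ⟩
  weightedSubsetSum m (peel m g)     ≡⟨ weightedSubsetSum≡weightedStirlingSum m (peel m g) ⟩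
  weightedStirlingSum m (peel m g)   ≡⟨ weightedStirlingSum-suc m g ⟨
  weightedStirlingSum (suc m) g      ∎
  where open ≡-Reasoning

mainTheorem15 : (m : ℕ) → lhs15 (suc m) ≡ rhs15 m
mainTheorem15 m = begin
  lhs15 (suc m)                          ≡⟨⟩
  weightedStirlingSum m ((- (+ 1)) ^_)   ≡⟨ weightedSubsetSum≡weightedStirlingSum m ((- (+ 1)) ^_) ⟨
  weightedSubsetSum m ((- (+ 1)) ^_)     ≡⟨ rhs15≡∑-subsets m ⟨
  rhs15 m                                ∎
  where open ≡-Reasoning
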